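{- Let $T$ be a finite rooted tree in which every inner node has at least two children, with leaf set $L$ and node set $V$. If $X\subseteq V\setminus L$ is thin, then there exists a pair $(\pi,\sigma)$ of injective maps from $X$ to $L$ that has unique request and identifies $X$.
   Context: A set $X\subseteq V\setminus L$ is thin if for each $x\in X$ that is not the root, the parent of $x$ does not belong to $X$, and $x$ has at least one sibling (possibly a leaf) not in $X$. A pair $(\pi,\sigma)$ of injective maps from $X$ to $L$ identifies $X$ if for each $s\in X$, $s$ is the least common ancestor of $\pi(s)$ and $\sigma(s)$ (every node is its own ancestor). A node $x$ is $s$-requested in $(\pi,\sigma)$ if it lies on the path from $\pi(s)$ to $\sigma(s)$; the pair has unique request if every node is $s$-requested for at most one $s\in X$. -}

module Defs where

open import Data.Nat using (ℕ; suc; _≤_)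
open import Data.Fin using (Fin; zero; suc; toℕ)
open import Data.Fin.Subset using (Subset; _∈_; _∉_)
open import Data.Product using (Σ; ∃; _×_)
open import Data.Sum using (_⊎_)
open import Relation.Binary.PropositionalEquality using (_≡_; _≢_)
open import Relation.Nullary using (¬_)

-- A finite rooted tree with node set Fin (suc n); node `zero` is the root and
-- node `suc i` has parent `par i`, whose index is smaller (so the parent
-- relation is acyclic and every node reaches the root). Every finite rooted
-- tree admits such a labelling (e.g. BFS order).
record Tree (n : ℕ) : Set where
  field
    par    : Fin n → Fin (suc n)
    par-lt : ∀ i → toℕ (par i) ≤ toℕ i

open Tree public

Node : ℕ → Set
Node n = Fin (suc n)

root : ∀ {n} → Node n
root = zero

Child : ∀ {n} → Tree n → Node n → Node n → Set
Child {n} T c v = Σ (Fin n) λ i → (c ≡ suc i) × (par T i ≡ v)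

IsLeaf : ∀ {n} → Tree n → Node n → Set
IsLeaf T v = ∀ c → ¬ Child T c v

AtLeastTwoChildren : ∀ {n} → Tree n → Set
AtLeastTwoChildren T = ∀ v c → Child T c v → Σ _ λ c′ → Child T c′ v × (c′ ≢ c)

data Ancestor {n} (T : Tree n) (a : Node n) : Node n → Set where
  self : Ancestor T a a
  up   : ∀ i → Ancestor T a (par T i) → Ancestor T a (suc i)

IsLCA : ∀ {n} → Tree n → Node n → Node n → Node n → Set
IsLCA T s u w =
  Ancestor T s u × Ancestor T s w ×
  (∀ z → Ancestor T z u → Ancestor T z w → Ancestor T z s)

-- x lies on the (unique) path from u to w in the tree:
-- x is an ancestor of u or of w, and a descendant of every common ancestor
OnPath : ∀ {n} → Tree n → Node n → Node n → Node n → Set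
OnPath T u w x =
  (Ancestor T x u ⊎ Ancestor T x w) ×
  (∀ z → Ancestor T z u → Ancestor T z w → Ancestor T z x)

Thin : ∀ {n} → Tree n → Subset (suc n) → Set
Thin {n} T X =
  (∀ x → x ∈ X → ¬ IsLeaf T x) ×
  (∀ (i : Fin n) → suc i ∈ X →
     (par T i ∉ X) ×
     (Σ (Fin n) λ j → (par T j ≡ par T i) × (j ≢ i) × (suc j ∉ X)))

-- π is an injective map from X to L (values outside X are irrelevant)
InjectiveToLeaves : ∀ {n} → Tree n → Subset (suc n) → (Node n → Node n) → Set
InjectiveToLeaves T X π =
  (∀ s → s ∈ X → IsLeaf T (π s)) ×
  (∀ s t → s ∈ X → t ∈ X → π s ≡ π t → s ≡ t)

Identifies : ∀ {n} → Tree n → Subset (suc n) → (Node n → Node n) → (Node n → Node n) → Set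
Identifies T X π σ = ∀ s → s ∈ X → IsLCA T s (π s) (σ s)

Requested : ∀ {n} → Tree n → (Node n → Node n) → (Node n → Node n) → Node n → Node n → Set
Requested T π σ s x = OnPath T (π s) (σ s) x

UniqueRequest : ∀ {n} → Tree n → Subset (suc n) → (Node n → Node n) → (Node n → Node n) → Set
UniqueRequest T X π σ =
  ∀ x s t → s ∈ X → t ∈ X → Requested T π σ s x → Requested T π σ t x → s ≡ t

{-# OPTIONS --safe #-}
module Submission where

-- For s ∈ X take two distinct children of s; thinness keeps both outside X. From each,
-- descend to a leaf, always stepping to a child outside X (thinness again supplies one),
-- so the X-ancestors of the two leaves π(s), σ(s) all lie weakly above s, and their LCA
-- is s because they sit below distinct siblings. Any node requested by both s and t
-- lies below s and on the way up from a leaf of t, so s is above t; by symmetry s = t.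
-- Injectivity follows in the same way from a common leaf.

open import Defs
open import Data.Nat using (ℕ; suc; _≤_; s≤s)
open import Data.Nat.Properties using (≤-refl; ≤-trans; m≤n⇒m≤1+n; 1+n≰n)
open import Data.Fin using (suc; toℕ; _>_)
open import Data.Fin.Properties using (any?; _≟_)
open import Data.Fin.Induction using (>-wellFounded)
open import Data.Fin.Subset using (Subset; _∈_; _∉_)
open import Data.Fin.Subset.Properties using (_∈?_)
open import Data.Product using (Σ; ∃; ∃-syntax; _×_; _,_; proj₁; proj₂; uncurry)
open import Data.Sum using (_⊎_; inj₁; inj₂)
open import Data.Empty using (⊥-elim)
open import Induction.WellFounded using (Acc; acc)
open import Relation.Nullary using (¬_; yes; no)
open import Relation.Unary using (Decidable)
open import Function using (_∘_)
open import Relation.Binary.PropositionalEquality using (_≡_; _≢_; refl; sym; trans; cong; subst)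

choice-on-Decidable : ∀ {A B : Set} {P : A → Set} {Q : A → B → Set} → Decidable P → B →
                      (∀ a → P a → ∃ (Q a)) → Σ (A → B) λ f → ∀ a → P a → Q a (f a)
choice-on-Decidable {Q = Q} P? default choose = (λ a → proj₁ (pick a)) , (λ a → proj₂ (pick a))
  where
    pick : ∀ a → Σ _ λ b → _ → Q a b
    pick a with P? a
    ... | yes pa = proj₁ (choose a pa) , λ _ → proj₂ (choose a pa)
    ... | no ¬pa = default , λ pa → ⊥-elim (¬pa pa)

module _ {n : ℕ} (T : Tree n) where

  Ancestor⇒≤ : ∀ {a v} → Ancestor T a v → toℕ a ≤ toℕ v
  Ancestor⇒≤ self     = ≤-refl
  Ancestor⇒≤ (up i a) = m≤n⇒m≤1+n (≤-trans (Ancestor⇒≤ a) (par-lt T i))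

  Ancestor-trans : ∀ {a b v} → Ancestor T a b → Ancestor T b v → Ancestor T a v
  Ancestor-trans a self     = a
  Ancestor-trans a (up i b) = up i (Ancestor-trans a b)

  parent-Ancestor : ∀ {v} i → par T i ≡ v → Ancestor T v (suc i)
  parent-Ancestor i refl = up i self

  parent<child : ∀ {v} i → par T i ≡ v → suc i > v
  parent<child i refl = s≤s (par-lt T i)

  child-not-Ancestor-parent : ∀ i → ¬ Ancestor T (suc i) (par T i)
  child-not-Ancestor-parent i a = 1+n≰n (≤-trans (Ancestor⇒≤ a) (par-lt T i))

  Ancestor-antisym : ∀ {a v} → Ancestor T a v → Ancestor T v a → a ≡ v
  Ancestor-antisym self     _ = refl
  Ancestor-antisym (up i a) b = ⊥-elim (child-not-Ancestor-parent i (Ancestor-trans b a))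

  Ancestor-comparable : ∀ {a b v} → Ancestor T a v → Ancestor T b v →
                        Ancestor T a b ⊎ Ancestor T b a
  Ancestor-comparable self      b         = inj₂ b
  Ancestor-comparable (up i a)  self      = inj₁ (up i a)
  Ancestor-comparable (up i a)  (up .i b) = Ancestor-comparable a b

  sibling-Ancestor⇒≡ : ∀ {i j} → par T i ≡ par T j → Ancestor T (suc i) (suc j) → i ≡ j
  sibling-Ancestor⇒≡ e self = refl
  sibling-Ancestor⇒≡ {i} e (up j a) =
    ⊥-elim (child-not-Ancestor-parent i (subst (Ancestor T (suc i)) (sym e) a))

  siblings-IsLCA : ∀ {s u w i j} → par T i ≡ s → par T j ≡ s → i ≢ j →
                   Ancestor T (suc i) u → Ancestor T (suc j) w → IsLCA T s u w
  siblings-IsLCA {s} {u} {w} {i} {j} pi pj i≢j iu jw =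
    Ancestor-trans (parent-Ancestor i pi) iu , Ancestor-trans (parent-Ancestor j pj) jw , common
    where
      i-not-above-w : ¬ Ancestor T (suc i) w
      i-not-above-w iw with Ancestor-comparable iw jw
      ... | inj₁ ij = i≢j (sibling-Ancestor⇒≡ (trans pi (sym pj)) ij)
      ... | inj₂ ji = i≢j (sym (sibling-Ancestor⇒≡ (trans pj (sym pi)) ji))

      common : ∀ z → Ancestor T z u → Ancestor T z w → Ancestor T z s
      common z zu zw with Ancestor-comparable zu iu
      ... | inj₁ self        = ⊥-elim (i-not-above-w zw)
      ... | inj₁ (up .i zp)  = subst (Ancestor T z) pi zp
      ... | inj₂ iz          = ⊥-elim (i-not-above-w (Ancestor-trans iz zw))

  IsLCA⇒Ancestor-OnPath : ∀ {s u w x} → IsLCA T s u w → OnPath T u w x → Ancestor T s x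
  IsLCA⇒Ancestor-OnPath {s} (su , sw , _) (_ , below-common) = below-common s su sw

  leaf-or-child : ∀ v → IsLeaf T v ⊎ ∃[ i ] par T i ≡ v
  leaf-or-child v with any? (λ i → par T i ≟ v)
  ... | yes child   = inj₂ child
  ... | no  noChild = inj₁ λ { c (i , _ , pi) → noChild (i , pi) }

  module _ (X : Subset (suc n)) where

    record FreeLeaf (v ℓ : Node n) : Set where
      constructor freeLeaf
      field
        isLeaf            : IsLeaf T ℓ
        below             : Ancestor T v ℓ
        X-ancestors-above : ∀ z → z ∈ X → Ancestor T z ℓ → Ancestor T z v

    open FreeLeaf

    FreeLeaf-parent : ∀ {v ℓ} i → par T i ≡ v → suc i ∉ X → FreeLeaf (suc i) ℓ → FreeLeaf v ℓ
    FreeLeaf-parent {v} {ℓ} i pi i∉X f =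
      freeLeaf (isLeaf f) (Ancestor-trans (parent-Ancestor i pi) (below f)) above
      where
        above : ∀ z → z ∈ X → Ancestor T z ℓ → Ancestor T z v
        above z z∈X zℓ with X-ancestors-above f z z∈X zℓ
        ... | self      = ⊥-elim (i∉X z∈X)
        ... | up .i zp  = subst (Ancestor T z) pi zp

    FreeLeaf-injective : ∀ {s t ℓ} → s ∈ X → t ∈ X → FreeLeaf s ℓ → FreeLeaf t ℓ → s ≡ t
    FreeLeaf-injective s∈X t∈X fs ft =
      Ancestor-antisym (X-ancestors-above ft _ s∈X (below fs)) (X-ancestors-above fs _ t∈X (below ft))

    FreeLeaf⇒InjectiveToLeaves : (π : Node n → Node n) → (∀ s → s ∈ X → FreeLeaf s (π s)) →
                                 InjectiveToLeaves T X π
    FreeLeaf⇒InjectiveToLeaves π free =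
      (λ s s∈X → isLeaf (free s s∈X)) ,
      λ s t s∈X t∈X e →
        FreeLeaf-injective s∈X t∈X (free s s∈X) (subst (FreeLeaf t) (sym e) (free t t∈X))

    record IdentifyingPair (s u w : Node n) : Set where
      field
        left  : FreeLeaf s u
        right : FreeLeaf s w
        lca   : IsLCA T s u w

    open IdentifyingPair

    IdentifyingPair-X-ancestors : ∀ {s u w z x} → IdentifyingPair s u w → z ∈ X →
                                  Ancestor T z x → OnPath T u w x → Ancestor T z s
    IdentifyingPair-X-ancestors p z∈X zx (inj₁ xu , _) =
      X-ancestors-above (left p) _ z∈X (Ancestor-trans zx xu)
    IdentifyingPair-X-ancestors p z∈X zx (inj₂ xw , _) =
      X-ancestors-above (right p) _ z∈X (Ancestor-trans zx xw)

    IdentifyingPair⇒UniqueRequest : (π σ : Node n → Node n) →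
                                    (∀ s → s ∈ X → IdentifyingPair s (π s) (σ s)) →
                                    UniqueRequest T X π σ
    IdentifyingPair⇒UniqueRequest π σ pair x s t s∈X t∈X xs xt =
      Ancestor-antisym (shared-request⇒Ancestor s∈X t∈X xs xt) (shared-request⇒Ancestor t∈X s∈X xt xs)
      where
        shared-request⇒Ancestor : ∀ {s t} → s ∈ X → t ∈ X →
                                  Requested T π σ s x → Requested T π σ t x → Ancestor T s t
        shared-request⇒Ancestor s∈X t∈X xs xt =
          IdentifyingPair-X-ancestors (pair _ t∈X) s∈X (IsLCA⇒Ancestor-OnPath (lca (pair _ s∈X)) xs) xt

    HasSiblingOutside : Set
    HasSiblingOutside = ∀ i → suc i ∈ X → ∃[ j ] par T j ≡ par T i × suc j ∉ X

    module _ (escape : HasSiblingOutside) where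

      child-outside : ∀ {v} i → par T i ≡ v → ∃[ j ] par T j ≡ v × suc j ∉ X
      child-outside i pi with suc i ∈? X
      ... | no  i∉X = i , pi , i∉X
      ... | yes i∈X with escape i i∈X
      ...   | j , pj , j∉X = j , trans pj pi , j∉X

      FreeLeaf-exists : ∀ v → ∃ (FreeLeaf v)
      FreeLeaf-exists v = descend v (>-wellFounded v)
        where
          descend : ∀ v → Acc _>_ v → ∃ (FreeLeaf v)
          descend v (acc smaller) with leaf-or-child v
          ... | inj₁ leaf     = v , freeLeaf leaf self (λ _ _ zv → zv)
          ... | inj₂ (i , pi) with child-outside i pi
          ...   | j , pj , j∉X with descend (suc j) (smaller (parent<child j pj))
          ...     | ℓ , f = ℓ , FreeLeaf-parent j pj j∉X f

      IdentifyingPair-exists : ∀ {s i j} → par T i ≡ s → par T j ≡ s → i ≢ j →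
                               suc i ∉ X → suc j ∉ X → ∃ (uncurry (IdentifyingPair s))
      IdentifyingPair-exists {i = i} {j} pi pj i≢j i∉X j∉X
        with FreeLeaf-exists (suc i) | FreeLeaf-exists (suc j)
      ... | u , fu | w , fw = (u , w) , record
        { left  = FreeLeaf-parent i pi i∉X fu
        ; right = FreeLeaf-parent j pj j∉X fw
        ; lca   = siblings-IsLCA pi pj i≢j (below fu) (below fw)
        }

    module _ (thin : Thin T X) where

      Thin⇒HasSiblingOutside : HasSiblingOutside
      Thin⇒HasSiblingOutside i i∈X with proj₂ (proj₂ thin i i∈X)
      ... | j , pj , _ , j∉X = j , pj , j∉X

      Thin-children-outside : ∀ {s} i → par T i ≡ s → s ∈ X → suc i ∉ X
      Thin-children-outside i refl s∈X i∈X = proj₁ (proj₂ thin i i∈X) s∈X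

      Thin⇒IdentifyingPair : AtLeastTwoChildren T → ∀ s → s ∈ X → ∃ (uncurry (IdentifyingPair s))
      Thin⇒IdentifyingPair two s s∈X with leaf-or-child s
      ... | inj₁ leaf = ⊥-elim (proj₁ thin s s∈X leaf)
      ... | inj₂ (i , pi) with two s (suc i) (i , refl , pi)
      ...   | _ , (j , refl , pj) , j≢i =
        IdentifyingPair-exists Thin⇒HasSiblingOutside pi pj (j≢i ∘ cong suc ∘ sym)
          (Thin-children-outside i pi s∈X) (Thin-children-outside j pj s∈X)

lemma3p8 : ∀ (n : ℕ) (T : Tree n) → AtLeastTwoChildren T →
    (X : Subset (suc n)) → Thin T X →
    Σ (Node n → Node n) λ π → Σ (Node n → Node n) λ σ →
      InjectiveToLeaves T X π × InjectiveToLeaves T X σ ×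
      UniqueRequest T X π σ × Identifies T X π σ
lemma3p8 n T two X thin
  with choice-on-Decidable {Q = uncurry ∘ IdentifyingPair T X} (_∈? X) (root , root)
         (Thin⇒IdentifyingPair T X thin two)
... | endpoints , pair =
  π , σ ,
  FreeLeaf⇒InjectiveToLeaves T X π (λ s s∈X → IdentifyingPair.left (pair s s∈X)) ,
  FreeLeaf⇒InjectiveToLeaves T X σ (λ s s∈X → IdentifyingPair.right (pair s s∈X)) ,
  IdentifyingPair⇒UniqueRequest T X π σ pair ,
  λ s s∈X → IdentifyingPair.lca (pair s s∈X)
  where
    π σ : Node n → Node n
    π = proj₁ ∘ endpoints
    σ = proj₂ ∘ endpoints
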